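{- Let $d,n\in\mathbb{N}$ with $3\leq d\leq n/4$, let $V$ be a set of $n$ vertices, and let $S\subseteq V$ with $|S|\leq n/6$. Let $H$ be a graph with vertex set $S$ and let $F$ be a bipartite graph with bipartition $(S,V\setminus S)$ such that $\Delta(F\cup H)\leq d$. Let $u\in S$ and $v\in V\setminus S$ with $uv\notin E(F)$. Then $$\mathbb{P}[uv\in E(G_{n,d})\mid G_{n,d}[S]=H,\ F\subseteq G_{n,d}]\leq \frac{6(d-d_H(u)-d_F(u))}{n}.$$
   Context: $G_{n,d}$ is a uniformly random simple $d$-regular graph on vertex set $V$. $d_G(u)$ denotes the degree of $u$ in $G$, $\Delta(G)$ the maximum degree, and $G[S]$ the induced subgraph on $S$. -}

module Defs where

open import Data.Nat using (ℕ; zero; suc; _+_)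
open import Data.Bool using (Bool; true; false; _∧_; _∨_; not; T)
open import Data.Fin using (Fin; zero; suc)
open import Data.Fin.Subset using (Subset)
open import Data.Vec using (lookup)
open import Data.List using (List; []; _∷_; map; concatMap; length; filterᵇ; allFin; foldr)
open import Data.List using (sum)
open import Relation.Binary.PropositionalEquality using (_≡_)

-- A graph on vertex set V = Fin n is given by its adjacency function.
-- Simple graphs correspond bijectively to symmetric irreflexive adjacency
-- functions (IsSimple).
Graph : ℕ → Set
Graph n = Fin n → Fin n → Bool

record IsSimple {n : ℕ} (G : Graph n) : Set where
  field
    irrefl : ∀ i → G i i ≡ false
    sym    : ∀ i j → G i j ≡ G j i

_∈ᵇ_ : {n : ℕ} → Fin n → Subset n → Bool
i ∈ᵇ S = lookup S i

deg : {n : ℕ} → Graph n → Fin n → ℕ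
deg {n} G u = length (filterᵇ (G u) (allFin n))

_∪ᴳ_ : {n : ℕ} → Graph n → Graph n → Graph n
(F ∪ᴳ H) i j = F i j ∨ H i j

MaxDegAtMost : {n : ℕ} → Graph n → ℕ → Set
MaxDegAtMost G d = ∀ u → deg G u Data.Nat.≤ d

allFuns : {A : Set} → List A → (m : ℕ) → List (Fin m → A)
allFuns xs zero    = (λ ()) ∷ []
allFuns xs (suc m) =
  concatMap (λ a → map (λ f → λ { zero → a ; (suc i) → f i }) (allFuns xs m)) xs

allGraphs : (n : ℕ) → List (Graph n)
allGraphs n = allFuns (allFuns (false ∷ true ∷ []) n) n

∀ᵇ : {n : ℕ} → (Fin n → Bool) → Bool
∀ᵇ {n} p = foldr (λ i b → p i ∧ b) true (allFin n)

_⇔ᵇ_ : Bool → Bool → Bool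
true  ⇔ᵇ b = b
false ⇔ᵇ b = not b

_⇒ᵇ_ : Bool → Bool → Bool
a ⇒ᵇ b = not a ∨ b

_=ℕᵇ_ : ℕ → ℕ → Bool
zero  =ℕᵇ zero  = true
zero  =ℕᵇ suc _ = false
suc _ =ℕᵇ zero  = false
suc m =ℕᵇ suc n = m =ℕᵇ n

isSimpleRegularᵇ : {n : ℕ} → ℕ → Graph n → Bool
isSimpleRegularᵇ d G =
  ∀ᵇ (λ i → not (G i i) ∧ ∀ᵇ (λ j → G i j ⇔ᵇ G j i) ∧ (deg G i =ℕᵇ d))

-- G[S] = H  (H a graph with vertex set S, stored as a graph on Fin n)
inducedEqᵇ : {n : ℕ} → Subset n → Graph n → Graph n → Bool
inducedEqᵇ S G H =
  ∀ᵇ (λ i → ∀ᵇ (λ j → ((i ∈ᵇ S) ∧ (j ∈ᵇ S)) ⇒ᵇ (G i j ⇔ᵇ H i j)))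

subgraphᵇ : {n : ℕ} → Graph n → Graph n → Bool
subgraphᵇ F G = ∀ᵇ (λ i → ∀ᵇ (λ j → F i j ⇒ᵇ G i j))

countReg : (n d : ℕ) → (Graph n → Bool) → ℕ
countReg n d p = length (filterᵇ (λ G → isSimpleRegularᵇ d G ∧ p G) (allGraphs n))

condEvent : {n : ℕ} → Subset n → Graph n → Graph n → Graph n → Bool
condEvent S H F G = inducedEqᵇ S G H ∧ subgraphᵇ F G

-- A switching argument.  Say (G, x, y) is a forward switching if G is in the conditioned space, uv ∈ G, and
-- xy ∈ G with x, y ∉ S, y ≠ v and ux, vy ∉ G.  Replacing uv, xy by ux, vy keeps G d-regular, keeps G[S] = H and
-- F ⊆ G, and gives a backward switching: a graph with ux ∈ G, ux ∉ F, x ∉ S and vy ∈ G.  Each G has at least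
-- nd/6 forward switchings (of its nd oriented edges xy at most 2d(d + |S|) are excluded), while each graph has at
-- most (d − d_H(u) − d_F(u))·d backward ones.  For fixed (x, y) the switching is xor with a fixed graph, hence a
-- bijection on all graphs, so counting the triples (G, x, y) both ways gives
-- (nd/6)·#{G conditioned, uv ∈ G} ≤ (d − d_H(u) − d_F(u))·d·#{G conditioned}.

module Submission where

open import Defs
open import Data.Bool using (Bool; true; false; _∧_; _∨_; not; _xor_)
open import Data.Bool.Properties
  using (∧-identityʳ; ∧-zeroʳ; ∧-comm; ∧-conicalˡ; ∧-conicalʳ; ∨-comm; ∨-identityʳ; ∨-conicalˡ; ∨-conicalʳ;
         xor-identityʳ; xor-comm; true-xor; ¬-not; not-injective)
open import Data.Empty using (⊥; ⊥-elim)
open import Data.Fin using (Fin; zero; suc)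
open import Data.Fin.Properties using (_≟_)
open import Data.Fin.Subset using (Subset; _∈_; _∉_; ∣_∣)
open import Data.List using (List; []; _∷_; map; length; filterᵇ; tabulate; allFin; concatMap; _++_; foldr)
open import Data.List.Properties using (map-++; map-cong; map-∘)
open import Data.Nat using (ℕ; zero; suc; _+_; _*_; _∸_; _≤_; z≤n; s≤s; >-nonZero)
import Data.Nat.ListAction as ListAction
open import Data.Nat.ListAction.Properties using (sum-++)
open import Data.Nat.Properties hiding (_≟_; ≡ᵇ⇒≡)
open import Data.Nat.Tactic.RingSolver using (solve-∀)
open import Data.Product using (_×_; _,_; proj₁; proj₂)
open import Data.Sum using (_⊎_; inj₁; inj₂; [_,_])
open import Data.Vec using ([]; _∷_)
open import Data.Vec.Properties using ([]=⇒lookup; lookup⇒[]=)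
open import Data.Vec.Functional using (Vector) renaming (_∷_ to _◂_)
open import Data.Vec.Functional.Relation.Binary.Pointwise using (Pointwise)
open import Function using (_∘_)
open import Relation.Binary.Core using (_Preserves_⟶_)
open import Relation.Binary.Definitions using (Reflexive)
open import Relation.Binary.PropositionalEquality
  using (_≡_; _≢_; refl; sym; trans; cong; cong₂; subst; ≢-sym; module ≡-Reasoning)
open import Relation.Nullary using (Dec; yes; no)
open import Relation.Nullary.Decidable using (does; dec-true; dec-false)
open import Algebra.Properties.CommutativeSemigroup +-commutativeSemigroup using (xy∙z≈xz∙y)
open import Algebra.Properties.Semiring.Sum +-*-semiring
  using (sum; sum-syntax; sum-cong-≗; ∑-distrib-+; ∑-comm; *-distribˡ-sum)

𝟙 : Bool → ℕ
𝟙 true  = 1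
𝟙 false = 0

𝟙-∧ : ∀ a b → 𝟙 (a ∧ b) ≡ 𝟙 a * 𝟙 b
𝟙-∧ true  b = sym (+-identityʳ (𝟙 b))
𝟙-∧ false b = refl

𝟙-∨ : ∀ a b → 𝟙 (a ∨ b) ≤ 𝟙 a + 𝟙 b
𝟙-∨ true  b = s≤s z≤n
𝟙-∨ false b = ≤-refl

𝟙-∨₃ : ∀ a b c → 𝟙 (a ∨ b ∨ c) ≤ 𝟙 a + 𝟙 b + 𝟙 c
𝟙-∨₃ true  b     c = s≤s z≤n
𝟙-∨₃ false true  c = s≤s z≤n
𝟙-∨₃ false false c = ≤-refl

𝟙-∧-≤ : ∀ a b → 𝟙 (a ∧ b) ≤ 𝟙 a
𝟙-∧-≤ true  true  = ≤-refl
𝟙-∧-≤ true  false = z≤n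
𝟙-∧-≤ false b     = z≤n

𝟙-mono : ∀ {a b} → (a ≡ true → b ≡ true) → 𝟙 a ≤ 𝟙 b
𝟙-mono {false} a⇒b = z≤n
𝟙-mono {true}  a⇒b rewrite a⇒b refl = ≤-refl

𝟙-union-bound : ∀ p a b → 𝟙 p ≤ 𝟙 (p ∧ not a ∧ not b) + (𝟙 a * 𝟙 p + 𝟙 b * 𝟙 p)
𝟙-union-bound false a     b     = z≤n
𝟙-union-bound true  false false = s≤s z≤n
𝟙-union-bound true  false true  = s≤s z≤n
𝟙-union-bound true  true  b     = s≤s z≤n

true≢false : true ≢ false
true≢false ()

∧-intro : ∀ {a b} → a ≡ true → b ≡ true → a ∧ b ≡ true
∧-intro refl refl = refl

⇔ᵇ-sound : ∀ {a b} → (a ⇔ᵇ b) ≡ true → a ≡ b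
⇔ᵇ-sound {true}  {true}  _ = refl
⇔ᵇ-sound {false} {false} _ = refl

⇔ᵇ-refl : ∀ a → (a ⇔ᵇ a) ≡ true
⇔ᵇ-refl true  = refl
⇔ᵇ-refl false = refl

⇒ᵇ-sound : ∀ {a b} → (a ⇒ᵇ b) ≡ true → a ≡ true → b ≡ true
⇒ᵇ-sound {true} a⇒b refl = a⇒b

⇒ᵇ-complete : ∀ {a b} → (a ≡ true → b ≡ true) → (a ⇒ᵇ b) ≡ true
⇒ᵇ-complete {true}  a⇒b = a⇒b refl
⇒ᵇ-complete {false} a⇒b = refl

=ℕᵇ-sound : ∀ {m n} → (m =ℕᵇ n) ≡ true → m ≡ n
=ℕᵇ-sound {zero}  {zero}  _ = refl
=ℕᵇ-sound {suc m} {suc n} e = cong suc (=ℕᵇ-sound e)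

=ℕᵇ-refl : ∀ m → (m =ℕᵇ m) ≡ true
=ℕᵇ-refl zero    = refl
=ℕᵇ-refl (suc m) = =ℕᵇ-refl m

_≡ᵇ_ : ∀ {n} → Fin n → Fin n → Bool
i ≡ᵇ j = does (i ≟ j)

≡ᵇ-refl : ∀ {n} (i : Fin n) → i ≡ᵇ i ≡ true
≡ᵇ-refl i = dec-true (i ≟ i) refl

≢⇒≡ᵇ-false : ∀ {n} {i j : Fin n} → i ≢ j → i ≡ᵇ j ≡ false
≢⇒≡ᵇ-false {i = i} {j} = dec-false (i ≟ j)

≡ᵇ⇒≡ : ∀ {n} {i j : Fin n} → i ≡ᵇ j ≡ true → i ≡ j
≡ᵇ⇒≡ {i = i} {j} e with i ≟ j
... | yes i≡j = i≡j

count : ∀ {n} → (Fin n → Bool) → ℕ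
count {n} p = ∑[ i < n ] 𝟙 (p i)

∑-mono-≤ : ∀ {n} {f g : Vector ℕ n} → (∀ i → f i ≤ g i) → sum f ≤ sum g
∑-mono-≤ {zero}  f≤g = z≤n
∑-mono-≤ {suc n} f≤g = +-mono-≤ (f≤g zero) (∑-mono-≤ (f≤g ∘ suc))

∑-const : ∀ n c → ∑[ i < n ] c ≡ n * c
∑-const zero    c = refl
∑-const (suc n) c = cong (c +_) (∑-const n c)

∑-zero : ∀ n → ∑[ i < n ] 0 ≡ 0
∑-zero n = trans (∑-const n 0) (*-zeroʳ n)

count-cong : ∀ {n} {p q : Fin n → Bool} → (∀ i → p i ≡ q i) → count p ≡ count q
count-cong p≗q = sum-cong-≗ (cong 𝟙 ∘ p≗q)

count-∧-≡ᵇ : ∀ {n} (p : Fin n → Bool) b → count (λ j → p j ∧ (j ≡ᵇ b)) ≡ 𝟙 (p b)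
count-∧-≡ᵇ {suc n} p zero = begin
  𝟙 (p zero ∧ true) + count (λ j → p (suc j) ∧ false)
    ≡⟨ cong₂ _+_ (cong 𝟙 (∧-identityʳ (p zero))) (count-cong (∧-zeroʳ ∘ p ∘ suc)) ⟩
  𝟙 (p zero) + ∑[ j < n ] 0
    ≡⟨ cong (𝟙 (p zero) +_) (∑-zero n) ⟩
  𝟙 (p zero) + 0
    ≡⟨ +-identityʳ (𝟙 (p zero)) ⟩
  𝟙 (p zero) ∎
  where open ≡-Reasoning
count-∧-≡ᵇ {suc n} p (suc b) =
  trans (cong (λ c → 𝟙 c + count (λ j → p (suc j) ∧ (j ≡ᵇ b))) (∧-zeroʳ (p zero)))
        (count-∧-≡ᵇ (p ∘ suc) b)

count-≡ᵇ : ∀ {n} (b : Fin n) → count (_≡ᵇ b) ≡ 1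
count-≡ᵇ = count-∧-≡ᵇ (λ _ → true)

count-xor-≡ᵇ : ∀ {n} (f : Fin n → Bool) b →
  count (λ j → f j xor (j ≡ᵇ b)) + 𝟙 (f b) ≡ count f + 𝟙 (not (f b))
count-xor-≡ᵇ {n} f b = begin
  count (λ j → f j xor (j ≡ᵇ b)) + 𝟙 (f b)
    ≡⟨ cong (count (λ j → f j xor (j ≡ᵇ b)) +_) (count-∧-≡ᵇ f b) ⟨
  count (λ j → f j xor (j ≡ᵇ b)) + count (λ j → f j ∧ (j ≡ᵇ b))
    ≡⟨ ∑-distrib-+ {n} _ _ ⟨
  ∑[ j < n ] (𝟙 (f j xor (j ≡ᵇ b)) + 𝟙 (f j ∧ (j ≡ᵇ b)))
    ≡⟨ sum-cong-≗ (λ j → flip-bit (f j) (j ≡ᵇ b)) ⟩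
  ∑[ j < n ] (𝟙 (f j) + 𝟙 (not (f j) ∧ (j ≡ᵇ b)))
    ≡⟨ ∑-distrib-+ {n} _ _ ⟩
  count f + count (λ j → not (f j) ∧ (j ≡ᵇ b))
    ≡⟨ cong (count f +_) (count-∧-≡ᵇ (not ∘ f) b) ⟩
  count f + 𝟙 (not (f b)) ∎
  where
  open ≡-Reasoning
  flip-bit : ∀ g e → 𝟙 (g xor e) + 𝟙 (g ∧ e) ≡ 𝟙 g + 𝟙 (not g ∧ e)
  flip-bit true  true  = refl
  flip-bit true  false = refl
  flip-bit false true  = refl
  flip-bit false false = refl

countPairs : ∀ {n} → (Fin n → Fin n → Bool) → ℕ
countPairs {n} p = ∑[ i < n ] count (p i)

countPairs-∧ : ∀ {n} (p q : Fin n → Bool) → countPairs (λ i j → p i ∧ q j) ≡ count p * count q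
countPairs-∧ {n} p q = begin
  ∑[ i < n ] ∑[ j < n ] 𝟙 (p i ∧ q j)        ≡⟨ sum-cong-≗ (λ i → sum-cong-≗ λ j → 𝟙-∧ (p i) (q j)) ⟩
  ∑[ i < n ] ∑[ j < n ] (𝟙 (p i) * 𝟙 (q j))  ≡⟨ sum-cong-≗ (λ i → *-distribˡ-sum (𝟙 (p i)) (𝟙 ∘ q)) ⟨
  ∑[ i < n ] (𝟙 (p i) * count q)             ≡⟨ sum-cong-≗ (λ i → *-comm (𝟙 (p i)) (count q)) ⟩
  ∑[ i < n ] (count q * 𝟙 (p i))             ≡⟨ *-distribˡ-sum (count q) (𝟙 ∘ p) ⟨
  count q * count p                          ≡⟨ *-comm (count q) (count p) ⟩
  count p * count q                          ∎
  where open ≡-Reasoning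

∑ᴸ : {A : Set} → List A → (A → ℕ) → ℕ
∑ᴸ xs w = ListAction.sum (map w xs)

length-filterᵇ : {A : Set} (p : A → Bool) (xs : List A) → length (filterᵇ p xs) ≡ ∑ᴸ xs (𝟙 ∘ p)
length-filterᵇ p []       = refl
length-filterᵇ p (x ∷ xs) with p x
... | true  = cong suc (length-filterᵇ p xs)
... | false = length-filterᵇ p xs

∑ᴸ-tabulate : {A : Set} {m : ℕ} (f : Fin m → A) (w : A → ℕ) → ∑ᴸ (tabulate f) w ≡ ∑[ i < m ] w (f i)
∑ᴸ-tabulate {m = zero}  f w = refl
∑ᴸ-tabulate {m = suc m} f w = cong (w (f zero) +_) (∑ᴸ-tabulate (f ∘ suc) w)

∑ᴸ-cong : {A : Set} (xs : List A) {w w′ : A → ℕ} → (∀ a → w a ≡ w′ a) → ∑ᴸ xs w ≡ ∑ᴸ xs w′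
∑ᴸ-cong xs w≗w′ = cong ListAction.sum (map-cong w≗w′ xs)

∑ᴸ-mono : {A : Set} (xs : List A) {w w′ : A → ℕ} → (∀ a → w a ≤ w′ a) → ∑ᴸ xs w ≤ ∑ᴸ xs w′
∑ᴸ-mono []       w≤w′ = z≤n
∑ᴸ-mono (x ∷ xs) w≤w′ = +-mono-≤ (w≤w′ x) (∑ᴸ-mono xs w≤w′)

∑ᴸ-map : {A B : Set} (f : A → B) (xs : List A) (w : B → ℕ) → ∑ᴸ (map f xs) w ≡ ∑ᴸ xs (w ∘ f)
∑ᴸ-map f xs w = cong ListAction.sum (sym (map-∘ xs))

∑ᴸ-concatMap : {A B : Set} (k : A → List B) (xs : List A) (w : B → ℕ) →
  ∑ᴸ (concatMap k xs) w ≡ ∑ᴸ xs (λ a → ∑ᴸ (k a) w)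
∑ᴸ-concatMap k []       w = refl
∑ᴸ-concatMap k (x ∷ xs) w = begin
  ListAction.sum (map w (k x ++ concatMap k xs))          ≡⟨ cong ListAction.sum (map-++ w (k x) _) ⟩
  ListAction.sum (map w (k x) ++ map w (concatMap k xs))  ≡⟨ sum-++ (map w (k x)) _ ⟩
  ∑ᴸ (k x) w + ∑ᴸ (concatMap k xs) w                      ≡⟨ cong (∑ᴸ (k x) w +_) (∑ᴸ-concatMap k xs w) ⟩
  ∑ᴸ (k x) w + ∑ᴸ xs (λ a → ∑ᴸ (k a) w)                   ∎
  where open ≡-Reasoning

*-distribˡ-∑ᴸ : {A : Set} (c : ℕ) (xs : List A) (w : A → ℕ) → c * ∑ᴸ xs w ≡ ∑ᴸ xs (λ a → c * w a)
*-distribˡ-∑ᴸ c []       w = *-zeroʳ c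
*-distribˡ-∑ᴸ c (x ∷ xs) w = trans (*-distribˡ-+ c (w x) _) (cong (c * w x +_) (*-distribˡ-∑ᴸ c xs w))

∑ᴸ-∑-comm : {A : Set} {m : ℕ} (xs : List A) (f : A → Fin m → ℕ) →
  ∑ᴸ xs (λ a → ∑[ i < m ] f a i) ≡ ∑[ i < m ] ∑ᴸ xs (λ a → f a i)
∑ᴸ-∑-comm {m = m} []       f = sym (∑-zero m)
∑ᴸ-∑-comm {m = m} (x ∷ xs) f =
  trans (cong (sum (f x) +_) (∑ᴸ-∑-comm xs f)) (sym (∑-distrib-+ {m} (f x) _))

double-counting : {A : Set} {m : ℕ} (xs : List A) (p q : A → Fin m → Fin m → Bool) →
  (∀ i j → ∑ᴸ xs (λ a → 𝟙 (p a i j)) ≤ ∑ᴸ xs (λ a → 𝟙 (q a i j))) →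
  ∑ᴸ xs (λ a → countPairs (p a)) ≤ ∑ᴸ xs (λ a → countPairs (q a))
double-counting {m = m} xs p q pairwise = begin
  ∑ᴸ xs (λ a → countPairs (p a))                     ≡⟨ swap p ⟩
  ∑[ i < m ] ∑[ j < m ] ∑ᴸ xs (λ a → 𝟙 (p a i j))    ≤⟨ ∑-mono-≤ (λ i → ∑-mono-≤ (pairwise i)) ⟩
  ∑[ i < m ] ∑[ j < m ] ∑ᴸ xs (λ a → 𝟙 (q a i j))    ≡⟨ swap q ⟨
  ∑ᴸ xs (λ a → countPairs (q a))                     ∎
  where
  open ≤-Reasoning
  swap : ∀ r → ∑ᴸ xs (λ a → countPairs (r a)) ≡ ∑[ i < m ] ∑[ j < m ] ∑ᴸ xs (λ a → 𝟙 (r a i j))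
  swap r = trans (∑ᴸ-∑-comm xs (λ a i → count (r a i)))
                 (sum-cong-≗ {m} λ i → ∑ᴸ-∑-comm xs (λ a j → 𝟙 (r a i j)))

-- Weights must respect R because allFuns builds its functions from pattern lambdas,
-- which agree with a ◂ g only pointwise.
SumInvariant : {A : Set} → (A → A → Set) → List A → (A → A) → Set
SumInvariant R xs f = ∀ w → w Preserves R ⟶ _≡_ → ∑ᴸ xs (w ∘ f) ≡ ∑ᴸ xs w

module _ {A : Set} (R : A → A → Set) where

  SumInvariant-∘ : ∀ {xs f g} → SumInvariant R xs f → SumInvariant R xs g → g Preserves R ⟶ R →
    SumInvariant R xs (g ∘ f)
  SumInvariant-∘ {g = g} f-inv g-inv g-resp w w-resp =
    trans (f-inv (w ∘ g) (w-resp ∘ g-resp)) (g-inv w w-resp)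

  module _ (R-refl : Reflexive R) (xs : List A) where

    ∑ᴸ-allFuns-suc : ∀ {m} {w : (Fin (suc m) → A) → ℕ} → w Preserves Pointwise R ⟶ _≡_ →
      ∑ᴸ (allFuns xs (suc m)) w ≡ ∑ᴸ xs (λ a → ∑ᴸ (allFuns xs m) (λ g → w (a ◂ g)))
    ∑ᴸ-allFuns-suc {m} {w} w-resp = trans (∑ᴸ-concatMap _ xs w) (∑ᴸ-cong xs λ a →
      trans (∑ᴸ-map _ (allFuns xs m) w)
            (∑ᴸ-cong (allFuns xs m) λ g → w-resp λ { zero → R-refl ; (suc i) → R-refl }))

    allFuns-invariant : ∀ m (f : Fin m → A → A) → (∀ i → SumInvariant R xs (f i)) →
      (∀ i → f i Preserves R ⟶ R) → SumInvariant (Pointwise R) (allFuns xs m) (λ g i → f i (g i))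
    allFuns-invariant zero    f f-inv f-resp w w-resp = cong (_+ 0) (w-resp λ ())
    allFuns-invariant (suc m) f f-inv f-resp w w-resp = begin
      ∑ᴸ (allFuns xs (suc m)) (w ∘ F)
        ≡⟨ ∑ᴸ-allFuns-suc (λ r → w-resp λ i → f-resp i (r i)) ⟩
      ∑ᴸ xs (λ a → ∑ᴸ (allFuns xs m) (λ g → w (F (a ◂ g))))
        ≡⟨ ∑ᴸ-cong xs (λ a → ∑ᴸ-cong (allFuns xs m) λ g → w-resp λ { zero → R-refl ; (suc i) → R-refl }) ⟩
      ∑ᴸ xs (λ a → ∑ᴸ (allFuns xs m) (λ g → w (f zero a ◂ F′ g)))
        ≡⟨ ∑ᴸ-cong xs (λ a → allFuns-invariant m (f ∘ suc) (f-inv ∘ suc) (f-resp ∘ suc) _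
                               λ r → w-resp λ { zero → R-refl ; (suc i) → r i }) ⟩
      ∑ᴸ xs (W ∘ f zero)
        ≡⟨ f-inv zero W (λ r → ∑ᴸ-cong (allFuns xs m) λ g → w-resp λ { zero → r ; (suc i) → R-refl }) ⟩
      ∑ᴸ xs W
        ≡⟨ ∑ᴸ-allFuns-suc w-resp ⟨
      ∑ᴸ (allFuns xs (suc m)) w ∎
      where
      open ≡-Reasoning
      F : (Fin (suc m) → A) → Fin (suc m) → A
      F g i = f i (g i)
      F′ : (Fin m → A) → Fin m → A
      F′ g i = f (suc i) (g i)
      W : A → ℕ
      W c = ∑ᴸ (allFuns xs m) (λ g → w (c ◂ g))

xor-invariant : ∀ c → SumInvariant _≡_ (false ∷ true ∷ []) (_xor c)
xor-invariant false w _ = refl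
xor-invariant true  w _
  rewrite +-identityʳ (w true) | +-identityʳ (w false) = +-comm (w true) (w false)

module _ {n : ℕ} (p : Fin n → Bool) where

  ∀ᵇ-sound : ∀ᵇ p ≡ true → ∀ i → p i ≡ true
  ∀ᵇ-sound = go (λ i → i)
    where
    go : ∀ {m} (f : Fin m → Fin n) → foldr (λ i b → p i ∧ b) true (tabulate f) ≡ true →
      ∀ i → p (f i) ≡ true
    go f all zero    = ∧-conicalˡ _ _ all
    go f all (suc i) = go (f ∘ suc) (∧-conicalʳ _ _ all) i

  ∀ᵇ-complete : (∀ i → p i ≡ true) → ∀ᵇ p ≡ true
  ∀ᵇ-complete all = go (λ i → i) (λ i → all i)
    where
    go : ∀ {m} (f : Fin m → Fin n) → (∀ i → p (f i) ≡ true) →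
      foldr (λ i b → p i ∧ b) true (tabulate f) ≡ true
    go {zero}  f all = refl
    go {suc m} f all rewrite all zero = go (f ∘ suc) (all ∘ suc)

∀ᵇ-cong : ∀ {n} {p q : Fin n → Bool} → (∀ i → p i ≡ q i) → ∀ᵇ p ≡ ∀ᵇ q
∀ᵇ-cong {n} {p} {q} p≗q = go (λ i → i)
  where
  go : ∀ {m} (f : Fin m → Fin n) →
    foldr (λ i b → p i ∧ b) true (tabulate f) ≡ foldr (λ i b → q i ∧ b) true (tabulate f)
  go {zero}  f = refl
  go {suc m} f = cong₂ _∧_ (p≗q (f zero)) (go (f ∘ suc))

∈⇒∈ᵇ : ∀ {n} {S : Subset n} {i} → i ∈ S → i ∈ᵇ S ≡ true
∈⇒∈ᵇ = []=⇒lookup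

∉⇒∈ᵇ : ∀ {n} {S : Subset n} {i} → i ∉ S → i ∈ᵇ S ≡ false
∉⇒∈ᵇ {S = S} {i} i∉S = ¬-not λ i∈S → i∉S (lookup⇒[]= i S i∈S)

separated : ∀ {n} (S : Subset n) {i j} → i ∈ᵇ S ≡ true → j ∈ᵇ S ≡ false → i ≢ j
separated S i∈S j∉S refl = true≢false (trans (sym i∈S) j∉S)

crossing⇒∈ᵇ-≢ : ∀ {n} {S : Subset n} {i j} → (i ∈ S × j ∉ S) ⊎ (i ∉ S × j ∈ S) → i ∈ᵇ S ≢ j ∈ᵇ S
crossing⇒∈ᵇ-≢ (inj₁ (i∈S , j∉S)) eq = true≢false (trans (sym (∈⇒∈ᵇ i∈S)) (trans eq (∉⇒∈ᵇ j∉S)))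
crossing⇒∈ᵇ-≢ (inj₂ (i∉S , j∈S)) eq = true≢false (trans (sym (∈⇒∈ᵇ j∈S)) (trans (sym eq) (∉⇒∈ᵇ i∉S)))

∣∣-count : ∀ {n} (S : Subset n) → ∣ S ∣ ≡ count (_∈ᵇ S)
∣∣-count []          = refl
∣∣-count (true ∷ S)  = cong suc (∣∣-count S)
∣∣-count (false ∷ S) = ∣∣-count S

deg-count : ∀ {n} (G : Graph n) i → deg G i ≡ count (G i)
deg-count {n} G i = trans (length-filterᵇ (G i) (allFin n)) (∑ᴸ-tabulate (λ j → j) (𝟙 ∘ G i))

deg-cong : ∀ {n} (G G′ : Graph n) i → (∀ j → G i j ≡ G′ i j) → deg G i ≡ deg G′ i
deg-cong G G′ i eq = trans (deg-count G i) (trans (count-cong eq) (sym (deg-count G′ i)))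

_≐_ : ∀ {n} → Graph n → Graph n → Set
_≐_ = Pointwise (Pointwise _≡_)

allGraphs-xor-invariant : ∀ {n} (N : Graph n) → SumInvariant _≐_ (allGraphs n) (λ G i j → G i j xor N i j)
allGraphs-xor-invariant {n} N =
  allFuns-invariant (Pointwise _≡_) (λ _ → refl) (allFuns (false ∷ true ∷ []) n) n
    (λ i g j → g j xor N i j)
    (λ i → allFuns-invariant _≡_ refl (false ∷ true ∷ []) n (λ j b → b xor N i j)
             (λ j → xor-invariant (N i j)) (λ j → cong (_xor N i j)))
    (λ i r j → cong (_xor N i j) (r j))

module _ {n : ℕ} where

  edge : Fin n → Fin n → Graph n
  edge a b i j = (i ≡ᵇ a ∧ j ≡ᵇ b) ∨ (i ≡ᵇ b ∧ j ≡ᵇ a)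

  edge-sym : ∀ a b i j → edge a b i j ≡ edge a b j i
  edge-sym a b i j =
    trans (∨-comm (i ≡ᵇ a ∧ j ≡ᵇ b) _) (cong₂ _∨_ (∧-comm (i ≡ᵇ b) _) (∧-comm (i ≡ᵇ a) _))

  edge-comm : ∀ a b i j → edge a b i j ≡ edge b a i j
  edge-comm a b i j = ∨-comm (i ≡ᵇ a ∧ j ≡ᵇ b) _

  edge-at : ∀ a b → edge a b a b ≡ true
  edge-at a b rewrite ≡ᵇ-refl a | ≡ᵇ-refl b = refl

  edge-true : ∀ {a b} i j → edge a b i j ≡ true → (i ≡ a × j ≡ b) ⊎ (i ≡ b × j ≡ a)
  edge-true {a} {b} i j e with i ≡ᵇ a in i≡a | j ≡ᵇ b in j≡b
  ... | true  | true  = inj₁ (≡ᵇ⇒≡ i≡a , ≡ᵇ⇒≡ j≡b)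
  ... | true  | false = inj₂ (≡ᵇ⇒≡ (∧-conicalˡ _ _ e) , ≡ᵇ⇒≡ (∧-conicalʳ _ _ e))
  ... | false | _     = inj₂ (≡ᵇ⇒≡ (∧-conicalˡ _ _ e) , ≡ᵇ⇒≡ (∧-conicalʳ _ _ e))

  edge-avoidˡ : ∀ {a b i} j → i ≢ a → i ≢ b → edge a b i j ≡ false
  edge-avoidˡ {i = i} j i≢a i≢b = ¬-not λ e → [ i≢a ∘ proj₁ , i≢b ∘ proj₁ ] (edge-true i j e)

  edge-avoidʳ : ∀ {a b j} i → j ≢ a → j ≢ b → edge a b i j ≡ false
  edge-avoidʳ {a} {b} {j} i j≢a j≢b = trans (edge-sym a b i j) (edge-avoidˡ i j≢a j≢b)

  edge-avoid-end : ∀ {a b i j} → i ≢ b → j ≢ b → edge a b i j ≡ false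
  edge-avoid-end {i = i} {j} i≢b j≢b = ¬-not λ e → [ j≢b ∘ proj₂ , i≢b ∘ proj₁ ] (edge-true i j e)

  edge-outside : ∀ {F a b i j} → IsSimple F → F i j ≡ true → F a b ≡ false → edge a b i j ≡ false
  edge-outside {F} {a} {b} {i} {j} F-simple ij∈F ab∉F = ¬-not λ e → ab∈F (edge-true i j e)
    where
    ab∈F : (i ≡ a × j ≡ b) ⊎ (i ≡ b × j ≡ a) → ⊥
    ab∈F (inj₁ (refl , refl)) = true≢false (trans (sym ij∈F) ab∉F)
    ab∈F (inj₂ (refl , refl)) = true≢false (trans (sym ij∈F) (trans (IsSimple.sym F-simple _ _) ab∉F))

  edge-irrefl : ∀ {a b} → a ≢ b → ∀ i → edge a b i i ≡ false
  edge-irrefl a≢b i = ¬-not λ e →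
    [ (λ (p , q) → a≢b (trans (sym p) q)) , (λ (p , q) → a≢b (trans (sym q) p)) ] (edge-true i i e)

  edge-row : ∀ {a b} → a ≢ b → ∀ j → edge a b a j ≡ (j ≡ᵇ b)
  edge-row {a} {b} a≢b j rewrite ≡ᵇ-refl a | ≢⇒≡ᵇ-false a≢b = ∨-identityʳ (j ≡ᵇ b)

  toggle : Fin n → Fin n → Graph n → Graph n
  toggle a b G i j = G i j xor edge a b i j

  toggle-away : ∀ {a b} G {i j} → edge a b i j ≡ false → toggle a b G i j ≡ G i j
  toggle-away G {i} {j} e = trans (cong (G i j xor_) e) (xor-identityʳ (G i j))

  toggle-at : ∀ a b G → toggle a b G a b ≡ not (G a b)
  toggle-at a b G =
    trans (cong (G a b xor_) (edge-at a b)) (trans (xor-comm (G a b) true) (true-xor (G a b)))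

  toggle-simple : ∀ {a b G} → a ≢ b → IsSimple G → IsSimple (toggle a b G)
  toggle-simple {a} {b} {G} a≢b G-simple = record
    { irrefl = λ i → cong₂ _xor_ (IsSimple.irrefl G-simple i) (edge-irrefl a≢b i)
    ; sym    = λ i j → cong₂ _xor_ (IsSimple.sym G-simple i j) (edge-sym a b i j)
    }

  ends : Fin n → Fin n → Fin n → ℕ
  ends a b i = 𝟙 (i ≡ᵇ a) + 𝟙 (i ≡ᵇ b)

  ends-left : ∀ {a b} → a ≢ b → ends a b a ≡ 1
  ends-left {a} a≢b rewrite ≡ᵇ-refl a | ≢⇒≡ᵇ-false a≢b = refl

  ends-right : ∀ {a b} → a ≢ b → ends a b b ≡ 1
  ends-right {b = b} a≢b rewrite ≡ᵇ-refl b | ≢⇒≡ᵇ-false (≢-sym a≢b) = refl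

  ends-away : ∀ {a b i} → i ≢ a → i ≢ b → ends a b i ≡ 0
  ends-away i≢a i≢b rewrite ≢⇒≡ᵇ-false i≢a | ≢⇒≡ᵇ-false i≢b = refl

  deg-toggle-at : ∀ {a b} G → a ≢ b → deg (toggle a b G) a + 𝟙 (G a b) ≡ deg G a + 𝟙 (not (G a b))
  deg-toggle-at {a} {b} G a≢b = begin
    deg (toggle a b G) a + 𝟙 (G a b)
      ≡⟨ cong (_+ 𝟙 (G a b)) (trans (deg-count (toggle a b G) a) (count-cong row)) ⟩
    count (λ j → G a j xor (j ≡ᵇ b)) + 𝟙 (G a b)
      ≡⟨ count-xor-≡ᵇ (G a) b ⟩
    count (G a) + 𝟙 (not (G a b))
      ≡⟨ cong (_+ 𝟙 (not (G a b))) (deg-count G a) ⟨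
    deg G a + 𝟙 (not (G a b)) ∎
    where
    open ≡-Reasoning
    row : ∀ j → toggle a b G a j ≡ G a j xor (j ≡ᵇ b)
    row j = cong (G a j xor_) (edge-row a≢b j)

  deg-toggle-away : ∀ {a b i} G → i ≢ a → i ≢ b → deg (toggle a b G) i ≡ deg G i
  deg-toggle-away {a} {b} {i} G i≢a i≢b =
    deg-cong (toggle a b G) G i (λ j → toggle-away G (edge-avoidˡ j i≢a i≢b))

  deg-toggle : ∀ {a b G} → IsSimple G → a ≢ b → ∀ i →
    deg (toggle a b G) i + 𝟙 (G a b) * ends a b i ≡ deg G i + 𝟙 (not (G a b)) * ends a b i
  deg-toggle {a} {b} {G} G-simple a≢b i = by-cases (i ≟ a) (i ≟ b)
    where
    by-cases : Dec (i ≡ a) → Dec (i ≡ b) →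
      deg (toggle a b G) i + 𝟙 (G a b) * ends a b i ≡ deg G i + 𝟙 (not (G a b)) * ends a b i
    by-cases (yes refl) _
      rewrite ends-left a≢b | *-identityʳ (𝟙 (G a b)) | *-identityʳ (𝟙 (not (G a b))) =
      deg-toggle-at G a≢b
    by-cases (no _) (yes refl)
      rewrite ends-right a≢b | *-identityʳ (𝟙 (G a b)) | *-identityʳ (𝟙 (not (G a b)))
            | deg-cong (toggle a b G) (toggle b a G) b (λ j → cong (G b j xor_) (edge-comm a b b j))
            | IsSimple.sym G-simple a b = deg-toggle-at G (≢-sym a≢b)
    by-cases (no i≢a) (no i≢b)
      rewrite ends-away i≢a i≢b | *-zeroʳ (𝟙 (G a b)) | *-zeroʳ (𝟙 (not (G a b))) =
      cong (_+ 0) (deg-toggle-away G i≢a i≢b)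

  deg-toggle-nonedge : ∀ {a b G} → IsSimple G → a ≢ b → G a b ≡ false →
    ∀ i → deg (toggle a b G) i ≡ deg G i + ends a b i
  deg-toggle-nonedge {a} {b} {G} G-simple a≢b ab∉G i = begin
    deg (toggle a b G) i                             ≡⟨ +-identityʳ _ ⟨
    deg (toggle a b G) i + 0                         ≡⟨ cong (λ g → deg (toggle a b G) i + 𝟙 g * ends a b i) ab∉G ⟨
    deg (toggle a b G) i + 𝟙 (G a b) * ends a b i    ≡⟨ deg-toggle G-simple a≢b i ⟩
    deg G i + 𝟙 (not (G a b)) * ends a b i           ≡⟨ cong (λ g → deg G i + 𝟙 (not g) * ends a b i) ab∉G ⟩
    deg G i + (ends a b i + 0)                       ≡⟨ cong (deg G i +_) (+-identityʳ _) ⟩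
    deg G i + ends a b i                             ∎
    where open ≡-Reasoning

  deg-toggle-edge : ∀ {a b G} → IsSimple G → a ≢ b → G a b ≡ true →
    ∀ i → deg (toggle a b G) i + ends a b i ≡ deg G i
  deg-toggle-edge {a} {b} {G} G-simple a≢b ab∈G i = begin
    deg (toggle a b G) i + ends a b i                ≡⟨ cong (deg (toggle a b G) i +_) (+-identityʳ _) ⟨
    deg (toggle a b G) i + (ends a b i + 0)          ≡⟨ cong (λ g → deg (toggle a b G) i + 𝟙 g * ends a b i) ab∈G ⟨
    deg (toggle a b G) i + 𝟙 (G a b) * ends a b i    ≡⟨ deg-toggle G-simple a≢b i ⟩
    deg G i + 𝟙 (not (G a b)) * ends a b i           ≡⟨ cong (λ g → deg G i + 𝟙 (not g) * ends a b i) ab∈G ⟩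
    deg G i + 0                                      ≡⟨ +-identityʳ _ ⟩
    deg G i                                          ∎
    where open ≡-Reasoning

toggle-cong : ∀ {n} (a b : Fin n) → toggle a b Preserves _≐_ ⟶ _≐_
toggle-cong a b r i j = cong (_xor edge a b i j) (r i j)

ends-cycle : ∀ {n} (u v x y i : Fin n) → ends u x i + ends v y i ≡ ends x y i + ends u v i
ends-cycle u v x y i = rearrange (𝟙 (i ≡ᵇ u)) (𝟙 (i ≡ᵇ v)) (𝟙 (i ≡ᵇ x)) (𝟙 (i ≡ᵇ y))
  where
  rearrange : ∀ U V X Y → U + X + (V + Y) ≡ X + Y + (U + V)
  rearrange = solve-∀

record IsRegular {n : ℕ} (d : ℕ) (G : Graph n) : Set where
  field
    simple : IsSimple G
    degree : ∀ i → deg G i ≡ d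

module _ {n : ℕ} (d : ℕ) {G : Graph n} where

  regularᵇ-sound : isSimpleRegularᵇ d G ≡ true → IsRegular d G
  regularᵇ-sound e = record
    { simple = record
      { irrefl = λ i → not-injective (∧-conicalˡ (not (G i i)) _ (row i))
      ; sym    = λ i j → ⇔ᵇ-sound (∀ᵇ-sound _ (∧-conicalˡ (symmetricᵇ i) _ (rest i)) j)
      }
    ; degree = λ i → =ℕᵇ-sound (∧-conicalʳ (symmetricᵇ i) _ (rest i))
    }
    where
    symmetricᵇ : Fin n → Bool
    symmetricᵇ i = ∀ᵇ (λ j → G i j ⇔ᵇ G j i)
    row : ∀ i → not (G i i) ∧ symmetricᵇ i ∧ (deg G i =ℕᵇ d) ≡ true
    row = ∀ᵇ-sound _ e
    rest : ∀ i → symmetricᵇ i ∧ (deg G i =ℕᵇ d) ≡ true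
    rest i = ∧-conicalʳ (not (G i i)) _ (row i)

  regularᵇ-complete : IsRegular d G → isSimpleRegularᵇ d G ≡ true
  regularᵇ-complete G-reg = ∀ᵇ-complete _ λ i →
    ∧-intro (cong not (IsSimple.irrefl simple i))
      (∧-intro (∀ᵇ-complete _ λ j →
                  subst (λ b → (G i j ⇔ᵇ b) ≡ true) (IsSimple.sym simple i j) (⇔ᵇ-refl (G i j)))
               (subst (λ m → (m =ℕᵇ d) ≡ true) (sym (degree i)) (=ℕᵇ-refl d)))
    where open IsRegular G-reg

regularᵇ-cong : ∀ {n} d {G G′ : Graph n} → G ≐ G′ → isSimpleRegularᵇ d G ≡ isSimpleRegularᵇ d G′
regularᵇ-cong d {G} {G′} G≐G′ = ∀ᵇ-cong λ i →
  cong₂ _∧_ (cong not (G≐G′ i i))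
    (cong₂ _∧_ (∀ᵇ-cong λ j → cong₂ _⇔ᵇ_ (G≐G′ i j) (G≐G′ j i))
               (cong (_=ℕᵇ d) (deg-cong G G′ i (G≐G′ i))))

record Conditioned {n : ℕ} (S : Subset n) (H F G : Graph n) : Set where
  field
    induced  : ∀ i j → i ∈ᵇ S ≡ true → j ∈ᵇ S ≡ true → G i j ≡ H i j
    contains : ∀ i j → F i j ≡ true → G i j ≡ true

module _ {n : ℕ} (S : Subset n) (H F : Graph n) {G : Graph n} where

  condEvent-sound : condEvent S H F G ≡ true → Conditioned S H F G
  condEvent-sound e = record
    { induced  = λ i j i∈S j∈S →
        ⇔ᵇ-sound (⇒ᵇ-sound (∀ᵇ-sound _ (∀ᵇ-sound _ inducedᵇ i) j) (∧-intro i∈S j∈S))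
    ; contains = λ i j → ⇒ᵇ-sound (∀ᵇ-sound _ (∀ᵇ-sound _ (∧-conicalʳ (inducedEqᵇ S G H) _ e) i) j)
    }
    where
    inducedᵇ : inducedEqᵇ S G H ≡ true
    inducedᵇ = ∧-conicalˡ (inducedEqᵇ S G H) _ e

  condEvent-complete : Conditioned S H F G → condEvent S H F G ≡ true
  condEvent-complete G-cond = ∧-intro
    (∀ᵇ-complete _ λ i → ∀ᵇ-complete _ λ j → ⇒ᵇ-complete λ ij∈S →
       subst (λ b → (G i j ⇔ᵇ b) ≡ true)
             (induced i j (∧-conicalˡ (i ∈ᵇ S) _ ij∈S) (∧-conicalʳ (i ∈ᵇ S) _ ij∈S))
             (⇔ᵇ-refl (G i j)))
    (∀ᵇ-complete _ λ i → ∀ᵇ-complete _ λ j → ⇒ᵇ-complete (contains i j))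
    where open Conditioned G-cond

condEvent-cong : ∀ {n} (S : Subset n) (H F : Graph n) {G G′ : Graph n} → G ≐ G′ →
  condEvent S H F G ≡ condEvent S H F G′
condEvent-cong S H F G≐G′ = cong₂ _∧_
  (∀ᵇ-cong λ i → ∀ᵇ-cong λ j → cong (λ b → ((i ∈ᵇ S) ∧ (j ∈ᵇ S)) ⇒ᵇ (b ⇔ᵇ H i j)) (G≐G′ i j))
  (∀ᵇ-cong λ i → ∀ᵇ-cong λ j → cong (F i j ⇒ᵇ_) (G≐G′ i j))

module _ {n d : ℕ} {G : Graph n} (G-reg : IsRegular d G) where
  open IsRegular G-reg

  count-neighbours : ∀ i → count (G i) ≡ d
  count-neighbours i = trans (sym (deg-count G i)) (degree i)

  countPairs-regular : countPairs G ≡ n * d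
  countPairs-regular = trans (sum-cong-≗ count-neighbours) (∑-const n d)

  ∑-row-weighted : (w : Fin n → ℕ) → ∑[ i < n ] ∑[ j < n ] (w i * 𝟙 (G i j)) ≡ d * sum w
  ∑-row-weighted w = begin
    ∑[ i < n ] ∑[ j < n ] (w i * 𝟙 (G i j))  ≡⟨ sum-cong-≗ (λ i → *-distribˡ-sum (w i) (𝟙 ∘ G i)) ⟨
    ∑[ i < n ] (w i * count (G i))           ≡⟨ sum-cong-≗ (λ i → cong (w i *_) (count-neighbours i)) ⟩
    ∑[ i < n ] (w i * d)                     ≡⟨ sum-cong-≗ (λ i → *-comm (w i) d) ⟩
    ∑[ i < n ] (d * w i)                     ≡⟨ *-distribˡ-sum d w ⟨
    d * sum w                                ∎
    where open ≡-Reasoning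

  ∑-column-weighted : (w : Fin n → ℕ) → ∑[ i < n ] ∑[ j < n ] (w j * 𝟙 (G i j)) ≡ d * sum w
  ∑-column-weighted w = begin
    ∑[ i < n ] ∑[ j < n ] (w j * 𝟙 (G i j))  ≡⟨ ∑-comm (λ i j → w j * 𝟙 (G i j)) ⟩
    ∑[ j < n ] ∑[ i < n ] (w j * 𝟙 (G i j))  ≡⟨ sum-cong-≗ (λ j → sum-cong-≗ λ i →
                                                  cong (λ b → w j * 𝟙 b) (IsSimple.sym simple i j)) ⟩
    ∑[ j < n ] ∑[ i < n ] (w j * 𝟙 (G j i))  ≡⟨ ∑-row-weighted w ⟩
    d * sum w                                ∎
    where open ≡-Reasoning

six-fold-bound : ∀ {n d s f} → 4 * d ≤ n → 6 * s ≤ n →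
  n * d ≤ f + (d * (s + d) + d * (s + d)) → n * d ≤ 6 * f
six-fold-bound {n} {d} {s} {f} 4d≤n 6s≤n nd≤ = +-cancelʳ-≤ (5 * (n * d)) (n * d) (6 * f) (begin
  n * d + 5 * (n * d)                              ≡⟨ e₁ n d ⟩
  6 * (n * d)                                      ≤⟨ *-monoʳ-≤ 6 nd≤ ⟩
  6 * (f + (d * (s + d) + d * (s + d)))            ≡⟨ e₂ f d s ⟩
  6 * f + (2 * d * (6 * s) + 3 * d * (4 * d))      ≤⟨ +-monoʳ-≤ (6 * f) (+-mono-≤ (*-monoʳ-≤ (2 * d) 6s≤n)
                                                                                 (*-monoʳ-≤ (3 * d) 4d≤n)) ⟩
  6 * f + (2 * d * n + 3 * d * n)                  ≡⟨ e₃ f d n ⟩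
  6 * f + 5 * (n * d)                              ∎)
  where
  open ≤-Reasoning
  e₁ : ∀ n d → n * d + 5 * (n * d) ≡ 6 * (n * d)
  e₁ = solve-∀
  e₂ : ∀ f d s → 6 * (f + (d * (s + d) + d * (s + d))) ≡ 6 * f + (2 * d * (6 * s) + 3 * d * (4 * d))
  e₂ = solve-∀
  e₃ : ∀ f d n → 6 * f + (2 * d * n + 3 * d * n) ≡ 6 * f + 5 * (n * d)
  e₃ = solve-∀

module Switching {n : ℕ} (d : ℕ) (S : Subset n) (H F : Graph n) (F-simple : IsSimple F)
  (H-inside : ∀ i j → H i j ≡ true → j ∈ᵇ S ≡ true)
  (F-crossing : ∀ i j → F i j ≡ true → i ∈ᵇ S ≢ j ∈ᵇ S)
  (u v : Fin n) (u∈S : u ∈ᵇ S ≡ true) (v∉S : v ∈ᵇ S ≡ false) (uv∉F : F u v ≡ false) where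

  switch : Fin n → Fin n → Graph n → Graph n
  switch x y = toggle x y ∘ toggle u v ∘ toggle v y ∘ toggle u x

  bad-x bad-y : Graph n → Fin n → Bool
  bad-x G x = x ∈ᵇ S ∨ G u x
  bad-y G y = y ∈ᵇ S ∨ y ≡ᵇ v ∨ G v y

  forward : Graph n → Fin n → Fin n → Bool
  forward G x y = G x y ∧ not (bad-x G x) ∧ not (bad-y G y)

  good-x : Graph n → Fin n → Bool
  good-x G x = G u x ∧ not (F u x) ∧ not (x ∈ᵇ S)

  backward : Graph n → Fin n → Fin n → Bool
  backward G x y = good-x G x ∧ G v y

  module Switch {G x y} (G-reg : IsRegular d G) (G-cond : Conditioned S H F G)
    (uv∈G : G u v ≡ true) (fwd : forward G x y ≡ true) where

    open IsRegular G-reg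
    open Conditioned G-cond

    xy∈G : G x y ≡ true
    xy∈G = ∧-conicalˡ (G x y) _ fwd

    x-ok : bad-x G x ≡ false
    x-ok = not-injective (∧-conicalˡ (not (bad-x G x)) _ (∧-conicalʳ (G x y) _ fwd))

    y-ok : bad-y G y ≡ false
    y-ok = not-injective (∧-conicalʳ (not (bad-x G x)) _ (∧-conicalʳ (G x y) _ fwd))

    x∉S : x ∈ᵇ S ≡ false
    x∉S = ∨-conicalˡ (x ∈ᵇ S) _ x-ok

    ux∉G : G u x ≡ false
    ux∉G = ∨-conicalʳ (x ∈ᵇ S) _ x-ok

    y∉S : y ∈ᵇ S ≡ false
    y∉S = ∨-conicalˡ (y ∈ᵇ S) _ y-ok

    y≢v : y ≢ v
    y≢v y≡v = true≢false (trans (sym (dec-true (y ≟ v) y≡v))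
                                (∨-conicalˡ (y ≡ᵇ v) _ (∨-conicalʳ (y ∈ᵇ S) _ y-ok)))

    vy∉G : G v y ≡ false
    vy∉G = ∨-conicalʳ (y ≡ᵇ v) _ (∨-conicalʳ (y ∈ᵇ S) _ y-ok)

    u≢v : u ≢ v
    u≢v = separated S u∈S v∉S
    u≢x : u ≢ x
    u≢x = separated S u∈S x∉S
    u≢y : u ≢ y
    u≢y = separated S u∈S y∉S
    x≢v : x ≢ v
    x≢v refl = true≢false (trans (sym uv∈G) ux∉G)
    x≢y : x ≢ y
    x≢y refl = true≢false (trans (sym xy∈G) (IsSimple.irrefl simple x))

    G₁ G₂ G₃ G₄ : Graph n
    G₁ = toggle u x G
    G₂ = toggle v y G₁
    G₃ = toggle u v G₂
    G₄ = toggle x y G₃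

    G₁-simple : IsSimple G₁
    G₁-simple = toggle-simple u≢x simple
    G₂-simple : IsSimple G₂
    G₂-simple = toggle-simple (≢-sym y≢v) G₁-simple
    G₃-simple : IsSimple G₃
    G₃-simple = toggle-simple u≢v G₂-simple
    G₄-simple : IsSimple G₄
    G₄-simple = toggle-simple x≢y G₃-simple

    open ≡-Reasoning

    vy∉G₁ : G₁ v y ≡ false
    vy∉G₁ = trans (toggle-away G (edge-avoidˡ y (≢-sym u≢v) (≢-sym x≢v))) vy∉G

    uv∈G₂ : G₂ u v ≡ true
    uv∈G₂ = begin
      G₂ u v  ≡⟨ toggle-away G₁ (edge-avoidˡ v u≢v u≢y) ⟩
      G₁ u v  ≡⟨ toggle-away G (edge-avoidʳ u (≢-sym u≢v) (≢-sym x≢v)) ⟩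
      G u v   ≡⟨ uv∈G ⟩
      true    ∎

    xy∈G₃ : G₃ x y ≡ true
    xy∈G₃ = begin
      G₃ x y  ≡⟨ toggle-away G₂ (edge-avoidˡ y (≢-sym u≢x) x≢v) ⟩
      G₂ x y  ≡⟨ toggle-away G₁ (edge-avoidˡ y x≢v x≢y) ⟩
      G₁ x y  ≡⟨ toggle-away G (edge-avoidʳ x (≢-sym u≢y) (≢-sym x≢y)) ⟩
      G x y   ≡⟨ xy∈G ⟩
      true    ∎

    ux∈G₄ : G₄ u x ≡ true
    ux∈G₄ = begin
      G₄ u x       ≡⟨ toggle-away G₃ (edge-avoidˡ x u≢x u≢y) ⟩
      G₃ u x       ≡⟨ toggle-away G₂ (edge-avoidʳ u (≢-sym u≢x) x≢v) ⟩
      G₂ u x       ≡⟨ toggle-away G₁ (edge-avoidˡ x u≢v u≢y) ⟩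
      G₁ u x       ≡⟨ toggle-at u x G ⟩
      not (G u x)  ≡⟨ cong not ux∉G ⟩
      true         ∎

    vy∈G₄ : G₄ v y ≡ true
    vy∈G₄ = begin
      G₄ v y        ≡⟨ toggle-away G₃ (edge-avoidˡ y (≢-sym x≢v) (≢-sym y≢v)) ⟩
      G₃ v y        ≡⟨ toggle-away G₂ (edge-avoidʳ v (≢-sym u≢y) y≢v) ⟩
      G₂ v y        ≡⟨ toggle-at v y G₁ ⟩
      not (G₁ v y)  ≡⟨ cong not vy∉G₁ ⟩
      true          ∎

    G₄-degree : ∀ i → deg G₄ i ≡ d
    G₄-degree i = +-cancelʳ-≡ (ends x y i + ends u v i) (deg G₄ i) d (begin
      deg G₄ i + (ends x y i + ends u v i)  ≡⟨ +-assoc (deg G₄ i) _ _ ⟨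
      deg G₄ i + ends x y i + ends u v i    ≡⟨ cong (_+ ends u v i) (deg-toggle-edge G₃-simple x≢y xy∈G₃ i) ⟩
      deg G₃ i + ends u v i                 ≡⟨ deg-toggle-edge G₂-simple u≢v uv∈G₂ i ⟩
      deg G₂ i                              ≡⟨ deg-toggle-nonedge G₁-simple (≢-sym y≢v) vy∉G₁ i ⟩
      deg G₁ i + ends v y i                 ≡⟨ cong (_+ ends v y i) (deg-toggle-nonedge simple u≢x ux∉G i) ⟩
      deg G i + ends u x i + ends v y i     ≡⟨ +-assoc (deg G i) _ _ ⟩
      deg G i + (ends u x i + ends v y i)   ≡⟨ cong₂ _+_ (degree i) (ends-cycle u v x y i) ⟩
      d + (ends x y i + ends u v i)         ∎)

    G₄-unchanged : ∀ {i j} → edge u x i j ≡ false → edge v y i j ≡ false →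
      edge u v i j ≡ false → edge x y i j ≡ false → G₄ i j ≡ G i j
    G₄-unchanged ux vy uv xy =
      trans (toggle-away G₃ xy) (trans (toggle-away G₂ uv) (trans (toggle-away G₁ vy) (toggle-away G ux)))

    ux∉F : F u x ≡ false
    ux∉F = ¬-not λ ux∈F → true≢false (trans (sym (contains u x ux∈F)) ux∉G)

    vy∉F : F v y ≡ false
    vy∉F = ¬-not λ vy∈F → true≢false (trans (sym (contains v y vy∈F)) vy∉G)

    xy∉F : F x y ≡ false
    xy∉F = ¬-not λ xy∈F → F-crossing x y xy∈F (trans x∉S (sym y∉S))

    G₄-conditioned : Conditioned S H F G₄
    G₄-conditioned = record
      { induced  = λ i j i∈S j∈S →
          let inside : ∀ {a b} → b ∈ᵇ S ≡ false → edge a b i j ≡ false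
              inside b∉S = edge-avoid-end (separated S i∈S b∉S) (separated S j∈S b∉S)
          in trans (G₄-unchanged (inside x∉S) (inside y∉S) (inside v∉S) (inside y∉S)) (induced i j i∈S j∈S)
      ; contains = λ i j ij∈F →
          let outside : ∀ {a b} → F a b ≡ false → edge a b i j ≡ false
              outside = edge-outside F-simple ij∈F
          in trans (G₄-unchanged (outside ux∉F) (outside vy∉F) (outside uv∉F) (outside xy∉F)) (contains i j ij∈F)
      }

    G₄-regular : IsRegular d G₄
    G₄-regular = record { simple = G₄-simple ; degree = G₄-degree }

    G₄-backward : backward G₄ x y ≡ true
    G₄-backward rewrite ux∈G₄ | ux∉F | x∉S | vy∈G₄ = refl

  conditionᵇ : Graph n → Bool
  conditionᵇ G = isSimpleRegularᵇ d G ∧ condEvent S H F G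

  eventᵇ : Graph n → Bool
  eventᵇ G = isSimpleRegularᵇ d G ∧ (condEvent S H F G ∧ G u v)

  eventᵇ-sound : ∀ {G} → eventᵇ G ≡ true → IsRegular d G × Conditioned S H F G × G u v ≡ true
  eventᵇ-sound {G} e =
    regularᵇ-sound d (∧-conicalˡ (isSimpleRegularᵇ d G) _ e) ,
    condEvent-sound S H F (∧-conicalˡ (condEvent S H F G) _ rest) ,
    ∧-conicalʳ (condEvent S H F G) _ rest
    where
    rest : condEvent S H F G ∧ G u v ≡ true
    rest = ∧-conicalʳ (isSimpleRegularᵇ d G) _ e

  conditionᵇ-sound : ∀ {G} → conditionᵇ G ≡ true → IsRegular d G × Conditioned S H F G
  conditionᵇ-sound {G} e =
    regularᵇ-sound d (∧-conicalˡ (isSimpleRegularᵇ d G) _ e) ,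
    condEvent-sound S H F (∧-conicalʳ (isSimpleRegularᵇ d G) _ e)

  switch-forward : ∀ G x y → eventᵇ G ∧ forward G x y ≡ true →
    conditionᵇ (switch x y G) ∧ backward (switch x y G) x y ≡ true
  switch-forward G x y e =
    ∧-intro (∧-intro (regularᵇ-complete d G₄-regular) (condEvent-complete S H F G₄-conditioned)) G₄-backward
    where
    event : IsRegular d G × Conditioned S H F G × G u v ≡ true
    event = eventᵇ-sound (∧-conicalˡ (eventᵇ G) _ e)
    open Switch (proj₁ event) (proj₁ (proj₂ event)) (proj₂ (proj₂ event)) (∧-conicalʳ (eventᵇ G) _ e)

  switch-invariant : ∀ x y → SumInvariant _≐_ (allGraphs n) (switch x y)
  switch-invariant x y =
    then-toggle x y (then-toggle u v (then-toggle v y (toggle-invariant u x)))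
    where
    toggle-invariant : ∀ a b → SumInvariant _≐_ (allGraphs n) (toggle a b)
    toggle-invariant a b = allGraphs-xor-invariant (edge a b)
    then-toggle : ∀ a b {f} → SumInvariant _≐_ (allGraphs n) f → SumInvariant _≐_ (allGraphs n) (toggle a b ∘ f)
    then-toggle a b {f} f-inv = SumInvariant-∘ _≐_ {allGraphs n} {f} f-inv (toggle-invariant a b) (toggle-cong a b)

  forward≤backward : ∀ x y → ∑ᴸ (allGraphs n) (λ G → 𝟙 (eventᵇ G ∧ forward G x y))
                           ≤ ∑ᴸ (allGraphs n) (λ G → 𝟙 (conditionᵇ G ∧ backward G x y))
  forward≤backward x y = ≤-trans
    (∑ᴸ-mono (allGraphs n) λ G → 𝟙-mono (switch-forward G x y))
    (≤-reflexive (switch-invariant x y _ λ G≐G′ → cong 𝟙 (cong₂ _∧_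
       (cong₂ _∧_ (regularᵇ-cong d G≐G′) (condEvent-cong S H F G≐G′))
       (cong₂ _∧_ (cong₂ _∧_ (G≐G′ u x) refl) (G≐G′ v y)))))

  module ForwardCount {G} (G-reg : IsRegular d G) (uv∈G : G u v ≡ true) where

    open IsRegular G-reg
    open ≤-Reasoning

    s : ℕ
    s = count (_∈ᵇ S)

    bad-x-count : count (bad-x G) ≤ s + d
    bad-x-count = begin
      count (bad-x G)                     ≤⟨ ∑-mono-≤ (λ x → 𝟙-∨ (x ∈ᵇ S) (G u x)) ⟩
      ∑[ x < n ] (𝟙 (x ∈ᵇ S) + 𝟙 (G u x)) ≡⟨ ∑-distrib-+ {n} _ _ ⟩
      s + count (G u)                     ≡⟨ cong (s +_) (count-neighbours G-reg u) ⟩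
      s + d                               ∎

    -- u is both in S and a neighbour of v, so it is counted twice on the right.
    bad-y-pointwise : ∀ y → 𝟙 (bad-y G y) + 𝟙 (y ≡ᵇ u) ≤ 𝟙 (y ∈ᵇ S) + 𝟙 (y ≡ᵇ v) + 𝟙 (G v y)
    bad-y-pointwise y = by-cases (y ≟ u)
      where
      by-cases : Dec (y ≡ u) → 𝟙 (bad-y G y) + 𝟙 (y ≡ᵇ u) ≤ 𝟙 (y ∈ᵇ S) + 𝟙 (y ≡ᵇ v) + 𝟙 (G v y)
      by-cases (yes refl)
        rewrite ≢⇒≡ᵇ-false (separated S u∈S v∉S) | u∈S | ≡ᵇ-refl u
              | IsSimple.sym simple v u | uv∈G = ≤-refl
      by-cases (no y≢u) rewrite ≢⇒≡ᵇ-false y≢u | +-identityʳ (𝟙 (bad-y G y)) =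
        𝟙-∨₃ (y ∈ᵇ S) (y ≡ᵇ v) (G v y)

    bad-y-count : count (bad-y G) ≤ s + d
    bad-y-count = +-cancelʳ-≤ 1 _ _ (begin
      count (bad-y G) + 1
        ≡⟨ cong (count (bad-y G) +_) (count-≡ᵇ u) ⟨
      count (bad-y G) + count (_≡ᵇ u)
        ≡⟨ ∑-distrib-+ {n} _ _ ⟨
      ∑[ y < n ] (𝟙 (bad-y G y) + 𝟙 (y ≡ᵇ u))
        ≤⟨ ∑-mono-≤ bad-y-pointwise ⟩
      ∑[ y < n ] (𝟙 (y ∈ᵇ S) + 𝟙 (y ≡ᵇ v) + 𝟙 (G v y))
        ≡⟨ ∑-distrib-+ {n} _ _ ⟩
      ∑[ y < n ] (𝟙 (y ∈ᵇ S) + 𝟙 (y ≡ᵇ v)) + count (G v)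
        ≡⟨ cong₂ _+_ (trans (∑-distrib-+ {n} _ _) (cong (s +_) (count-≡ᵇ v))) (count-neighbours G-reg v) ⟩
      s + 1 + d
        ≡⟨ xy∙z≈xz∙y s 1 d ⟩
      s + d + 1 ∎)

    forward-lower : n * d ≤ countPairs (forward G) + (d * (s + d) + d * (s + d))
    forward-lower = begin
      n * d
        ≡⟨ countPairs-regular G-reg ⟨
      ∑[ x < n ] ∑[ y < n ] 𝟙 (G x y)
        ≤⟨ ∑-mono-≤ (λ x → ∑-mono-≤ λ y → 𝟙-union-bound (G x y) (bad-x G x) (bad-y G y)) ⟩
      ∑[ x < n ] ∑[ y < n ] (𝟙 (forward G x y) + (𝟙 (bad-x G x) * 𝟙 (G x y) + 𝟙 (bad-y G y) * 𝟙 (G x y)))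
        ≡⟨ ∑∑-distrib-+ _ _ ⟩
      countPairs (forward G) + ∑[ x < n ] ∑[ y < n ] (𝟙 (bad-x G x) * 𝟙 (G x y) + 𝟙 (bad-y G y) * 𝟙 (G x y))
        ≡⟨ cong (countPairs (forward G) +_) (trans (∑∑-distrib-+ _ _)
             (cong₂ _+_ (∑-row-weighted G-reg (𝟙 ∘ bad-x G)) (∑-column-weighted G-reg (𝟙 ∘ bad-y G)))) ⟩
      countPairs (forward G) + (d * count (bad-x G) + d * count (bad-y G))
        ≤⟨ +-monoʳ-≤ (countPairs (forward G)) (+-mono-≤ (*-monoʳ-≤ d bad-x-count) (*-monoʳ-≤ d bad-y-count)) ⟩
      countPairs (forward G) + (d * (s + d) + d * (s + d)) ∎
      where
      ∑∑-distrib-+ : (f g : Fin n → Fin n → ℕ) →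
        ∑[ x < n ] ∑[ y < n ] (f x y + g x y) ≡ ∑[ x < n ] ∑[ y < n ] f x y + ∑[ x < n ] ∑[ y < n ] g x y
      ∑∑-distrib-+ f g = trans (sum-cong-≗ λ x → ∑-distrib-+ (f x) (g x)) (∑-distrib-+ {n} _ _)

  k : ℕ
  k = deg H u + deg F u

  module BackwardCount {G} (G-reg : IsRegular d G) (G-cond : Conditioned S H F G) where

    open Conditioned G-cond

    -- The H- and F-neighbours of u lie on opposite sides of the cut, and all of them are G-neighbours.
    neighbour-split : ∀ x → 𝟙 (H u x) + 𝟙 (F u x) + 𝟙 (good-x G x) ≤ 𝟙 (G u x)
    neighbour-split x with H u x in ux∈H | F u x in ux∈F
    ... | true | true = ⊥-elim (F-crossing u x ux∈F (trans u∈S (sym (H-inside u x ux∈H))))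
    ... | true | false
      rewrite H-inside u x ux∈H | trans (induced u x u∈S (H-inside u x ux∈H)) ux∈H = ≤-refl
    ... | false | true rewrite contains u x ux∈F = ≤-refl
    ... | false | false = 𝟙-∧-≤ (G u x) _

    good-x-count : k + count (good-x G) ≤ d
    good-x-count = begin
      deg H u + deg F u + count (good-x G)
        ≡⟨ cong₂ (λ h f → h + f + count (good-x G)) (deg-count H u) (deg-count F u) ⟩
      count (H u) + count (F u) + count (good-x G)
        ≡⟨ cong (_+ count (good-x G)) (∑-distrib-+ {n} _ _) ⟨
      ∑[ x < n ] (𝟙 (H u x) + 𝟙 (F u x)) + count (good-x G)
        ≡⟨ ∑-distrib-+ {n} _ _ ⟨
      ∑[ x < n ] (𝟙 (H u x) + 𝟙 (F u x) + 𝟙 (good-x G x))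
        ≤⟨ ∑-mono-≤ neighbour-split ⟩
      count (G u)
        ≡⟨ count-neighbours G-reg u ⟩
      d ∎
      where open ≤-Reasoning

    backward-upper : countPairs (backward G) ≤ (d ∸ k) * d
    backward-upper = begin
      countPairs (backward G)         ≡⟨ countPairs-∧ (good-x G) (G v) ⟩
      count (good-x G) * count (G v)  ≡⟨ cong (count (good-x G) *_) (count-neighbours G-reg v) ⟩
      count (good-x G) * d            ≤⟨ *-monoˡ-≤ d good-x≤d∸k ⟩
      (d ∸ k) * d                     ∎
      where
      open ≤-Reasoning
      good-x≤d∸k : count (good-x G) ≤ d ∸ k
      good-x≤d∸k = m+n≤o⇒m≤o∸n (count (good-x G)) (subst (_≤ d) (+-comm k _) good-x-count)

  forward-count : 4 * d ≤ n → 6 * ∣ S ∣ ≤ n →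
    ∀ G → n * d * 𝟙 (eventᵇ G) ≤ 6 * countPairs (λ x y → eventᵇ G ∧ forward G x y)
  forward-count 4d≤n 6∣S∣≤n G with eventᵇ G in e
  ... | false = ≤-trans (≤-reflexive (*-zeroʳ (n * d))) z≤n
  ... | true  = ≤-trans (≤-reflexive (*-identityʳ (n * d)))
                        (six-fold-bound {f = countPairs (forward G)} 4d≤n 6s≤n forward-lower)
    where
    open ForwardCount (proj₁ (eventᵇ-sound e)) (proj₂ (proj₂ (eventᵇ-sound e)))
    6s≤n : 6 * s ≤ n
    6s≤n = subst (λ m → 6 * m ≤ n) (∣∣-count S) 6∣S∣≤n

  backward-count : ∀ G →
    countPairs (λ x y → conditionᵇ G ∧ backward G x y) ≤ (d ∸ k) * d * 𝟙 (conditionᵇ G)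
  backward-count G with conditionᵇ G in e
  ... | false = ≤-trans (≤-reflexive (trans (sum-cong-≗ {n} λ _ → ∑-zero n) (∑-zero n))) z≤n
  ... | true  = ≤-trans backward-upper (≤-reflexive (sym (*-identityʳ ((d ∸ k) * d))))
    where open BackwardCount (proj₁ (conditionᵇ-sound e)) (proj₂ (conditionᵇ-sound e))

  switching-bound : 1 ≤ d → 4 * d ≤ n → 6 * ∣ S ∣ ≤ n →
    n * ∑ᴸ (allGraphs n) (𝟙 ∘ eventᵇ) ≤ 6 * (d ∸ k) * ∑ᴸ (allGraphs n) (𝟙 ∘ conditionᵇ)
  switching-bound 1≤d 4d≤n 6∣S∣≤n = *-cancelˡ-≤ d {{>-nonZero 1≤d}} (begin
    d * (n * ∑ᴸ Gs (𝟙 ∘ eventᵇ))                   ≡⟨ e₁ d n _ ⟩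
    n * d * ∑ᴸ Gs (𝟙 ∘ eventᵇ)                     ≡⟨ *-distribˡ-∑ᴸ (n * d) Gs _ ⟩
    ∑ᴸ Gs (λ G → n * d * 𝟙 (eventᵇ G))             ≤⟨ ∑ᴸ-mono Gs (forward-count 4d≤n 6∣S∣≤n) ⟩
    ∑ᴸ Gs (λ G → 6 * countPairs (Fwd G))           ≡⟨ *-distribˡ-∑ᴸ 6 Gs _ ⟨
    6 * ∑ᴸ Gs (countPairs ∘ Fwd)                   ≤⟨ *-monoʳ-≤ 6 (double-counting Gs Fwd Bwd forward≤backward) ⟩
    6 * ∑ᴸ Gs (countPairs ∘ Bwd)                   ≤⟨ *-monoʳ-≤ 6 (∑ᴸ-mono Gs backward-count) ⟩
    6 * ∑ᴸ Gs (λ G → (d ∸ k) * d * 𝟙 (conditionᵇ G))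
                                                   ≡⟨ cong (6 *_) (*-distribˡ-∑ᴸ ((d ∸ k) * d) Gs _) ⟨
    6 * ((d ∸ k) * d * ∑ᴸ Gs (𝟙 ∘ conditionᵇ))     ≡⟨ e₂ (d ∸ k) d _ ⟩
    d * (6 * (d ∸ k) * ∑ᴸ Gs (𝟙 ∘ conditionᵇ))     ∎)
    where
    open ≤-Reasoning
    Gs : List (Graph n)
    Gs = allGraphs n
    Fwd Bwd : Graph n → Fin n → Fin n → Bool
    Fwd G x y = eventᵇ G ∧ forward G x y
    Bwd G x y = conditionᵇ G ∧ backward G x y
    e₁ : ∀ d n A → d * (n * A) ≡ n * d * A
    e₁ = solve-∀
    e₂ : ∀ a d C → 6 * (a * d * C) ≡ d * (6 * a * C)
    e₂ = solve-∀

lemma3p1 : (n d : ℕ) → 3 ≤ d → 4 * d ≤ n →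
    (S : Subset n) → 6 * ∣ S ∣ ≤ n →
    (H : Graph n) → IsSimple H →
    (∀ i j → H i j ≡ true → (i ∈ S × j ∈ S)) →
    (F : Graph n) → IsSimple F →
    (∀ i j → F i j ≡ true → ((i ∈ S × j ∉ S) ⊎ (i ∉ S × j ∈ S))) →
    MaxDegAtMost (F ∪ᴳ H) d →
    (u v : Fin n) → u ∈ S → v ∉ S → F u v ≡ false →
    n * countReg n d (λ G → condEvent S H F G ∧ G u v)
      ≤ 6 * (d ∸ (deg H u + deg F u)) * countReg n d (condEvent S H F)
lemma3p1 n d 3≤d 4d≤n S 6∣S∣≤n H _ H⊆S F F-simple F-crossing _ u v u∈S v∉S uv∉F = begin
  n * countReg n d (λ G → condEvent S H F G ∧ G u v)   ≡⟨ cong (n *_) (length-filterᵇ _ (allGraphs n)) ⟩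
  n * ∑ᴸ (allGraphs n) (𝟙 ∘ eventᵇ)                    ≤⟨ switching-bound (≤-trans (s≤s z≤n) 3≤d) 4d≤n 6∣S∣≤n ⟩
  6 * (d ∸ k) * ∑ᴸ (allGraphs n) (𝟙 ∘ conditionᵇ)      ≡⟨ cong (6 * (d ∸ k) *_) (length-filterᵇ _ (allGraphs n)) ⟨
  6 * (d ∸ k) * countReg n d (condEvent S H F)         ∎
  where
  open ≤-Reasoning
  open Switching d S H F F-simple (λ i j ij∈H → ∈⇒∈ᵇ (proj₂ (H⊆S i j ij∈H)))
                 (λ i j ij∈F → crossing⇒∈ᵇ-≢ (F-crossing i j ij∈F)) u v (∈⇒∈ᵇ u∈S) (∉⇒∈ᵇ v∉S) uv∉F
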